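{- Let $\pi=\oplus[\xi_1,\dots,\xi_r]$ with $r\ge2$ where every $\xi_i$ is an increasing oscillation, identify each $\xi_i$ with the corresponding set of points in the diagram of $\pi$, and let $p=(p_1,p_2,\dots,p_n)$ be a pin representation of $\pi$. Then the only child $\xi_i$ which may be read in several pieces by $p$ is the child $\xi_{i_0}$ to which $p_1$ belongs. Moreover, if $p$ reads $\xi_{i_0}$ in several pieces, then it reads it in two pieces, the second child read by $p$ (the second child, in order of first appearance of its points in $p$) is either $\xi_{i_0-1}$ or $\xi_{i_0+1}$ and is a single point $x$, and the set $E=\xi_{i_0}\cup\{x\}$ is read in one piece by $p$.
   Context: $\oplus[\pi_1,\dots,\pi_r]$ is the permutation whose diagram consists of copies of the diagrams of $\pi_1,\dots,\pi_r$ placed in this order along an increasing diagonal. Let $\omega=3\,1\,5\,2\,7\,4\,9\,6\cdots(2k+1)\,(2k-2)\cdots$ be the infinite oscillating sequence. An increasing oscillation of size $n\ge4$ is a simple permutation (size $\ge4$, only trivial blocks) of size $n$ contained as a pattern in $\omega$; the increasing oscillations of size less than $4$ are $1$, $21$, $231$, $312$. A pin representation of a permutation is a sequence of points $(p_1,\dots,p_n)$, no two on a common horizontal or vertical line, order-isomorphic to its diagram (identified with it), such that each $p_i$ ($i\ge2$) lies outside the bounding box (smallest axis-parallel rectangle) of $\{p_1,\dots,p_{i-1}\}$ and either separates $p_{i-1}$ from $\{p_1,\dots,p_{i-2}\}$ (the horizontal or vertical line through $p_i$ has them on opposite sides) or does not separate $\{p_1,\dots,p_{i-1}\}$ into two nonempty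 sets. A set $D$ of points is read in $k$ pieces by $p$ if there are exactly $k$ maximal factors $p_i,\dots,p_{i+j}$ of $p$ consisting only of points of $D$. -}

module Defs where

open import Data.Nat using (ℕ; zero; suc; _+_; _∸_; _≤_; _<_; _≡ᵇ_; _<ᵇ_)
open import Data.Bool using (Bool; true; false; if_then_else_)
open import Data.List using (List; []; _∷_; length; _++_; map; upTo)
open import Data.List.Relation.Binary.Permutation.Propositional using (_↭_)
open import Data.List.Membership.Propositional using (_∈_)
open import Data.Product using (Σ; ∃; _×_; _,_)
open import Data.Sum using (_⊎_)
open import Relation.Nullary using (¬_)
open import Relation.Binary.PropositionalEquality using (_≡_)

-- Permutations are lists of values; a permutation of size n is a list
-- that is a rearrangement of 0,1,…,n-1 (values are 0-based; the
-- diagram of σ has points (k , σ(k)) for positions k = 0..n-1).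

-- total lookup (default 0; only used in range)
at : List ℕ → ℕ → ℕ
at []       _       = 0
at (x ∷ xs) zero    = x
at (x ∷ xs) (suc k) = at xs k

IsPerm : List ℕ → Set
IsPerm σ = σ ↭ upTo (length σ)

-- positions a..b-1 form a block: their values are exactly an interval
-- {c, …, c + (b-a) - 1}  (values are distinct as σ is a permutation)
IsBlock : List ℕ → ℕ → ℕ → Set
IsBlock σ a b = a < b × b ≤ length σ ×
  ∃ λ c → ∀ k → a ≤ k → k < b → c ≤ at σ k × at σ k < c + (b ∸ a)

IsSimple : List ℕ → Set
IsSimple σ = 4 ≤ length σ ×
  (∀ a b → IsBlock σ a b → (b ∸ a ≡ 1) ⊎ (b ∸ a ≡ length σ))

-- The infinite oscillating sequence ω = 3 1 5 2 7 4 9 6 …, 0-indexed: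
-- ω(0)=3, ω(1)=1, ω(2k)=2k+3, ω(2k+1)=2k for k ≥ 1.

ω : ℕ → ℕ
ω 0 = 3
ω 1 = 1
ω 3 = 2
ω (suc (suc n)) = 2 + ω n

ContainedInω : List ℕ → Set
ContainedInω σ = Σ (ℕ → ℕ) λ f →
  (∀ a b → a < b → b < length σ → f a < f b) ×
  (∀ a b → a < length σ → b < length σ →
     (at σ a < at σ b → ω (f a) < ω (f b)) × (ω (f a) < ω (f b) → at σ a < at σ b))

-- increasing oscillations: simple permutations contained in ω (size ≥ 4),
-- or one of 1, 21, 231, 312 (written 0-based)
SmallIncOsc : List (List ℕ)
SmallIncOsc = (0 ∷ []) ∷ (1 ∷ 0 ∷ []) ∷ (1 ∷ 2 ∷ 0 ∷ []) ∷ (2 ∷ 0 ∷ 1 ∷ []) ∷ []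

IsIncOsc : List ℕ → Set
IsIncOsc σ = IsPerm σ × ((IsSimple σ × ContainedInω σ) ⊎ σ ∈ SmallIncOsc)

⊕ : List (List ℕ) → List ℕ
⊕ []       = []
⊕ (σ ∷ σs) = σ ++ map (length σ +_) (⊕ σs)

-- index (0-based) of the child of ⊕ σs containing the point at position k
childIdx : List (List ℕ) → ℕ → ℕ
childIdx []       k = 0
childIdx (σ ∷ σs) k = if k <ᵇ length σ then 0 else suc (childIdx σs (k ∸ length σ))

childSize : List (List ℕ) → ℕ → ℕ
childSize []       j       = 0
childSize (σ ∷ σs) zero    = length σ
childSize (σ ∷ σs) (suc j) = childSize σs j

-- A pin representation of π (of size n) is
-- identified with an ordering p = (p_0,…,p_{n-1}) of the positions of π;
-- the i-th point of the sequence is (X i , Y i) = (p_i , π(p_i)).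

module _ (X Y : ℕ → ℕ) where

  Outside : ℕ → Set
  Outside i = (∀ j → j < i → X j < X i) ⊎ (∀ j → j < i → X i < X j)
            ⊎ (∀ j → j < i → Y j < Y i) ⊎ (∀ j → j < i → Y i < Y j)

  SepPrev : ℕ → Set
  SepPrev i =
      (X i < X (suc i) × (∀ j → j < i → X (suc i) < X j))
    ⊎ (X (suc i) < X i × (∀ j → j < i → X j < X (suc i)))
    ⊎ (Y i < Y (suc i) × (∀ j → j < i → Y (suc i) < Y j))
    ⊎ (Y (suc i) < Y i × (∀ j → j < i → Y j < Y (suc i)))

  NoSplit : ℕ → Set
  NoSplit i =
      ¬ (∃ λ j → ∃ λ k → j < i × k < i × X j < X i × X i < X k)
    × ¬ (∃ λ j → ∃ λ k → j < i × k < i × Y j < Y i × Y i < Y k)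

  IsPinSeq : ℕ → Set
  IsPinSeq n = ∀ i → suc i < n → Outside (suc i) × (SepPrev i ⊎ NoSplit (suc i))

IsPinRep : List ℕ → List ℕ → Set
IsPinRep π p = p ↭ upTo (length π) ×
  IsPinSeq (λ i → at p i) (λ i → at π (at p i)) (length π)

-- Number of pieces in which p reads the set of positions D:
-- the number of maximal factors of p consisting only of points of D.

piecesFrom : (ℕ → Bool) → Bool → List ℕ → ℕ
piecesFrom d prev []       = 0
piecesFrom d prev (x ∷ xs) with d x
... | false = piecesFrom d false xs
... | true  = (if prev then 0 else 1) + piecesFrom d true xs

pieces : (ℕ → Bool) → List ℕ → ℕ
pieces d p = piecesFrom d false p

inChild : List (List ℕ) → ℕ → ℕ → Bool
inChild σs j k = childIdx σs k ≡ᵇ j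

module Submission where

-- The only property of increasing oscillations that is used is that they are
-- sum-indecomposable (and nonempty); the key property of ⊕ is that points of an
-- earlier child lie below-left of points of a later one.

open import Defs
open import Data.Nat using (ℕ; zero; suc; _+_; _∸_; _≤_; _<_; z≤n; s≤s; _≡ᵇ_; _<ᵇ_)
open import Data.Nat.Properties
open import Data.Bool using (Bool; true; false; _∨_; if_then_else_; T)
open import Data.List using (List; []; _∷_; length; _++_; map; upTo)
open import Data.List.Properties using (length-++; length-map; length-upTo)
open import Data.List.Relation.Unary.All using (All; _∷_) renaming (map to All-map)
open import Data.List.Relation.Unary.Any using (here; there)
open import Data.List.Relation.Unary.AllPairs using (_∷_)
open import Data.List.Relation.Unary.Unique.Propositional using (Unique)
open import Data.List.Relation.Unary.Unique.Propositional.Properties using (upTo⁺)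
open import Data.List.Membership.Propositional using (_∈_)
open import Data.List.Membership.Propositional.Properties using (∈-upTo⁺; ∈-upTo⁻)
open import Data.List.Relation.Binary.Permutation.Propositional using (_↭_; ↭-sym; ↭⇒↭ₛ)
open import Data.List.Relation.Binary.Permutation.Propositional.Properties using (∈-resp-↭; ↭-length)
open import Data.Product using (∃; _×_; _,_; proj₁; proj₂)
open import Data.Sum using (_⊎_; inj₁; inj₂)
open import Data.Empty using (⊥; ⊥-elim)
open import Data.Unit using (tt)
open import Relation.Nullary using (¬_; Dec; yes; no; ¬?)
open import Relation.Nullary.Decidable using (decidable-stable)
open import Relation.Binary using (Tri; tri<; tri≈; tri>)
open import Relation.Binary.PropositionalEquality
  using (_≡_; _≢_; ≢-sym; refl; sym; trans; cong; subst; subst₂; setoid)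
open import Data.List.Relation.Binary.Permutation.Setoid.Properties (setoid ℕ) using (Unique-resp-↭)

-- 1. Lists as finite maps k ↦ at xs k

at-++ˡ : (xs ys : List ℕ) (k : ℕ) → k < length xs → at (xs ++ ys) k ≡ at xs k
at-++ˡ (x ∷ xs) ys zero    _         = refl
at-++ˡ (x ∷ xs) ys (suc k) (s≤s k<) = at-++ˡ xs ys k k<

at-++ʳ : (xs ys : List ℕ) (k : ℕ) → at (xs ++ ys) (length xs + k) ≡ at ys k
at-++ʳ []       ys k = refl
at-++ʳ (x ∷ xs) ys k = at-++ʳ xs ys k

at-map : (f : ℕ → ℕ) (xs : List ℕ) (k : ℕ) → k < length xs → at (map f xs) k ≡ f (at xs k)
at-map f (x ∷ xs) zero    _         = refl
at-map f (x ∷ xs) (suc k) (s≤s k<) = at-map f xs k k<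

at-∈ : (xs : List ℕ) (k : ℕ) → k < length xs → at xs k ∈ xs
at-∈ (x ∷ xs) zero    _         = here refl
at-∈ (x ∷ xs) (suc k) (s≤s k<) = there (at-∈ xs k k<)

∈⇒at : (xs : List ℕ) {v : ℕ} → v ∈ xs → ∃ λ k → k < length xs × at xs k ≡ v
∈⇒at (x ∷ xs) (here refl) = 0 , s≤s z≤n , refl
∈⇒at (x ∷ xs) (there v∈) with ∈⇒at xs v∈
... | k , k< , e = suc k , s≤s k< , e

All-at : ∀ {P : ℕ → Set} (xs : List ℕ) → All P xs → ∀ k → k < length xs → P (at xs k)
All-at (x ∷ xs) (px ∷ _)   zero    _         = px
All-at (x ∷ xs) (_  ∷ pxs) (suc k) (s≤s k<) = All-at xs pxs k k<

at-injective : (xs : List ℕ) → Unique xs →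
  ∀ k l → k < length xs → l < length xs → at xs k ≡ at xs l → k ≡ l
at-injective (x ∷ xs) (x∉ ∷ u) zero    zero    _ _ _ = refl
at-injective (x ∷ xs) (x∉ ∷ u) zero    (suc l) _ (s≤s l<) e = ⊥-elim (All-at xs x∉ l l< e)
at-injective (x ∷ xs) (x∉ ∷ u) (suc k) zero    (s≤s k<) _ e = ⊥-elim (All-at xs x∉ k k< (sym e))
at-injective (x ∷ xs) (x∉ ∷ u) (suc k) (suc l) (s≤s k<) (s≤s l<) e =
  cong suc (at-injective xs u k l k< l< e)

module PermutationOf (xs : List ℕ) (n : ℕ) (xs↭ : xs ↭ upTo n) where

  length≡ : length xs ≡ n
  length≡ = trans (↭-length xs↭) (length-upTo n)

  bounded : ∀ k → k < length xs → at xs k < n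
  bounded k k< = ∈-upTo⁻ (∈-resp-↭ xs↭ (at-∈ xs k k<))

  injective : ∀ k l → k < length xs → l < length xs → at xs k ≡ at xs l → k ≡ l
  injective = at-injective xs (Unique-resp-↭ (↭⇒↭ₛ (↭-sym xs↭)) (upTo⁺ n))

  surjective : ∀ v → v < n → ∃ λ k → k < length xs × at xs k ≡ v
  surjective v v< = ∈⇒at xs (∈-resp-↭ (↭-sym xs↭) (∈-upTo⁺ v<))

-- 2. Sum-indecomposability

pigeonhole : ∀ K M (f : ℕ → ℕ) → (∀ k → k < K → f k < M) →
  (∀ k l → k < K → l < K → f k ≡ f l → k ≡ l) → K ≤ M
pigeonhole zero    M       f bound inj = z≤n
pigeonhole (suc K) zero    f bound inj with bound 0 (s≤s z≤n)
... | ()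
pigeonhole (suc K) (suc M) f bound inj = s≤s (pigeonhole K M g g-bound g-inj)
  where
  -- g agrees with f except that the value M is replaced by the unused value f K
  g : ℕ → ℕ
  g k with f k ≟ M
  ... | yes _ = f K
  ... | no  _ = f k
  fK-fresh : ∀ k → k < K → f K ≢ f k
  fK-fresh k k<K e = <-irrefl (sym (inj K k (n<1+n K) (m<n⇒m<1+n k<K) e)) k<K
  g-bound : ∀ k → k < K → g k < M
  g-bound k k<K with f k ≟ M
  ... | yes e = ≤∧≢⇒< (≤-pred (bound K (n<1+n K))) (λ e' → fK-fresh k k<K (trans e' (sym e)))
  ... | no ne = ≤∧≢⇒< (≤-pred (bound k (m<n⇒m<1+n k<K))) ne
  g-inj : ∀ k l → k < K → l < K → g k ≡ g l → k ≡ l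
  g-inj k l k<K l<K e with f k ≟ M | f l ≟ M
  ... | yes a | yes b = inj k l (m<n⇒m<1+n k<K) (m<n⇒m<1+n l<K) (trans a (sym b))
  ... | yes _ | no  _ = ⊥-elim (fK-fresh l l<K e)
  ... | no  _ | yes _ = ⊥-elim (fK-fresh k k<K (sym e))
  ... | no  _ | no  _ = inj k l (m<n⇒m<1+n k<K) (m<n⇒m<1+n l<K) e

SumCut : List ℕ → ℕ → Set
SumCut σ K = ∀ a b → a < K → K ≤ b → b < length σ → at σ a < at σ b

SumIndecomposable : List ℕ → Set
SumIndecomposable σ = ∀ K → 0 < K → K < length σ → ¬ SumCut σ K

-- At a sum cut of a permutation, the entries left of the cut are exactly 0‥K-1:
-- an entry v ≥ K on the left would leave only n-K-1 values above it for the
-- n-K entries on the right.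
sumCut-prefix : (σ : List ℕ) → IsPerm σ → ∀ K → K < length σ → SumCut σ K →
  ∀ k → k < K → at σ k < K
sumCut-prefix σ σ-perm K K<n cut k k<K with at σ k <? K
... | yes v<K = v<K
... | no  v≮K = ⊥-elim (<⇒≱ (∸-monoʳ-< (n<1+n K) K<n) (pigeonhole (n ∸ K) (n ∸ suc K) f f-bound f-inj))
  where
  open PermutationOf σ (length σ) σ-perm
  n = length σ
  v = at σ k
  K≤v : K ≤ v
  K≤v = ≮⇒≥ v≮K
  right< : ∀ i → i < n ∸ K → K + i < n
  right< i i< = subst (K + i <_) (m+[n∸m]≡n (<⇒≤ K<n)) (+-monoʳ-< K i<)
  above-v : ∀ i → i < n ∸ K → v < at σ (K + i)
  above-v i i< = cut k (K + i) k<K (m≤m+n K i) (right< i i<)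
  f : ℕ → ℕ
  f i = at σ (K + i) ∸ suc v
  f-bound : ∀ i → i < n ∸ K → f i < n ∸ suc K
  f-bound i i< = <-≤-trans (∸-monoˡ-< (bounded (K + i) (right< i i<)) (above-v i i<)) (∸-monoʳ-≤ n (s≤s K≤v))
  f-inj : ∀ i j → i < n ∸ K → j < n ∸ K → f i ≡ f j → i ≡ j
  f-inj i j i< j< e = +-cancelˡ-≡ K i j (injective (K + i) (K + j) (right< i i<) (right< j j<)
    (∸-cancelʳ-≡ (above-v i i<) (above-v j j<) e))

-- A simple permutation is sum-indecomposable: a sum cut after K makes positions
-- 0‥K-1 a block (of size K, nontrivial unless K = 1), and for K = 1 positions
-- 1‥n-1 form a block of size n-1 ≥ 3.
simple⇒sumIndecomposable : (σ : List ℕ) → IsPerm σ → IsSimple σ → SumIndecomposable σ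
simple⇒sumIndecomposable σ σ-perm (4≤n , trivial) K 0<K K<n cut with K ≟ 1
... | yes refl = not-trivial (trivial 1 n (≤-trans (s≤s (s≤s z≤n)) 4≤n , ≤-refl , 1 , in-block))
  where
  open PermutationOf σ (length σ) σ-perm
  n = length σ
  n≡ : 1 + (n ∸ 1) ≡ n
  n≡ = m+[n∸m]≡n (≤-trans (s≤s z≤n) 4≤n)
  in-block : ∀ k → 1 ≤ k → k < n → 1 ≤ at σ k × at σ k < 1 + (n ∸ 1)
  in-block k 1≤k k<n = ≤-<-trans z≤n (cut 0 k (s≤s z≤n) 1≤k k<n) , subst (at σ k <_) (sym n≡) (bounded k k<n)
  not-trivial : (n ∸ 1 ≡ 1) ⊎ (n ∸ 1 ≡ n) → ⊥
  not-trivial (inj₁ e) = <⇒≱ (s≤s (s≤s (s≤s z≤n))) (subst (4 ≤_) (trans (sym n≡) (cong suc e)) 4≤n)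
  not-trivial (inj₂ e) = <-irrefl e (subst (n ∸ 1 <_) n≡ (n<1+n (n ∸ 1)))
... | no K≢1 = not-trivial (trivial 0 K (0<K , <⇒≤ K<n , 0 , in-block))
  where
  in-block : ∀ k → 0 ≤ k → k < K → 0 ≤ at σ k × at σ k < 0 + (K ∸ 0)
  in-block k _ k<K = z≤n , sumCut-prefix σ σ-perm K K<n cut k k<K
  not-trivial : (K ∸ 0 ≡ 1) ⊎ (K ∸ 0 ≡ length σ) → ⊥
  not-trivial (inj₁ e) = K≢1 e
  not-trivial (inj₂ e) = <-irrefl e K<n

small⇒sumIndecomposable : (σ : List ℕ) → σ ∈ SmallIncOsc → SumIndecomposable σ
small⇒sumIndecomposable _ (here refl) K 0<K (s≤s K<1) cut = <-irrefl refl (≤-trans 0<K K<1)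
small⇒sumIndecomposable _ (there (here refl)) 1 _ _ cut with cut 0 1 (s≤s z≤n) ≤-refl ≤-refl
... | ()
small⇒sumIndecomposable _ (there (here refl)) (suc (suc K)) _ (s≤s (s≤s ())) cut
small⇒sumIndecomposable _ (there (there (here refl))) 1 _ _ cut with cut 0 2 (s≤s z≤n) (s≤s z≤n) ≤-refl
... | ()
small⇒sumIndecomposable _ (there (there (here refl))) 2 _ _ cut with cut 1 2 (s≤s (s≤s z≤n)) ≤-refl ≤-refl
... | ()
small⇒sumIndecomposable _ (there (there (here refl))) (suc (suc (suc K))) _ (s≤s (s≤s (s≤s ()))) cut
small⇒sumIndecomposable _ (there (there (there (here refl)))) 1 _ _ cut with cut 0 1 (s≤s z≤n) ≤-refl (s≤s (s≤s z≤n))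
... | ()
small⇒sumIndecomposable _ (there (there (there (here refl)))) 2 _ _ cut with cut 0 2 (s≤s z≤n) ≤-refl ≤-refl
... | s≤s ()
small⇒sumIndecomposable _ (there (there (there (here refl)))) (suc (suc (suc K))) _ (s≤s (s≤s (s≤s ()))) cut
small⇒sumIndecomposable _ (there (there (there (there ()))))

IndecomposableBlock : List ℕ → Set
IndecomposableBlock σ = IsPerm σ × SumIndecomposable σ × 0 < length σ

incOsc⇒indecomposableBlock : (σ : List ℕ) → IsIncOsc σ → IndecomposableBlock σ
incOsc⇒indecomposableBlock σ (σ-perm , inj₁ (simple , _)) =
  σ-perm , simple⇒sumIndecomposable σ σ-perm simple , ≤-trans (s≤s z≤n) (proj₁ simple)
incOsc⇒indecomposableBlock σ (σ-perm , inj₂ small) = σ-perm , small⇒sumIndecomposable σ small , nonempty small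
  where
  nonempty : σ ∈ SmallIncOsc → 0 < length σ
  nonempty (here refl)                         = s≤s z≤n
  nonempty (there (here refl))                 = s≤s z≤n
  nonempty (there (there (here refl)))         = s≤s z≤n
  nonempty (there (there (there (here refl)))) = s≤s z≤n
  nonempty (there (there (there (there ()))))

first-failure : (D : ℕ → Set) → (∀ k → Dec (D k)) → ∀ l →
  (∀ a → a < l → D a) ⊎ (∃ λ K → K < l × ¬ D K × (∀ a → a < K → D a))
first-failure D D? zero = inj₁ (λ a ())
first-failure D D? (suc l) with first-failure D D? l
... | inj₂ (K , K< , ¬DK , below) = inj₂ (K , m<n⇒m<1+n K< , ¬DK , below)
... | inj₁ below with D? l
...   | no  ¬Dl = inj₂ (l , n<1+n l , ¬Dl , below)
...   | yes Dl  = inj₁ extended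
  where
  extended : ∀ a → a < suc l → D a
  extended a a< with m≤n⇒m<n∨m≡n (≤-pred a<)
  ... | inj₁ a<l  = below a a<l
  ... | inj₂ refl = Dl

-- A sum-indecomposable permutation has no proper decidable set of positions D
-- lying entirely below-left of its complement: the first position outside D
-- would be a sum cut.
no-lower-left-part : (σ : List ℕ) → SumIndecomposable σ → (D : ℕ → Set) → (∀ k → Dec (D k)) →
  ∀ k₀ l₀ → k₀ < length σ → l₀ < length σ → D k₀ → ¬ D l₀ →
  ¬ (∀ k l → k < length σ → l < length σ → D k → ¬ D l → k < l × at σ k < at σ l)
no-lower-left-part σ indec D D? k₀ l₀ k₀< l₀< Dk₀ ¬Dl₀ lower with first-failure D D? (suc l₀)
... | inj₁ all = ¬Dl₀ (all l₀ (n<1+n l₀))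
... | inj₂ (K , K≤l₀ , ¬DK , below) = indec K 0<K K<n cut
  where
  K<n : K < length σ
  K<n = ≤-<-trans (≤-pred K≤l₀) l₀<
  -- position 0 cannot lie right of the cut, since k₀ ∈ D lies left of every position outside D
  positive : ∀ K' → K' < length σ → ¬ D K' → 0 < K'
  positive zero    K'< ¬DK' = ⊥-elim (<⇒≱ (proj₁ (lower k₀ 0 k₀< K'< Dk₀ ¬DK')) z≤n)
  positive (suc _) _   _    = s≤s z≤n
  0<K : 0 < K
  0<K = positive K K<n ¬DK
  cut : SumCut σ K
  cut a b a<K K≤b b< with D? b
  ... | yes Db = ⊥-elim (<⇒≱ (proj₁ (lower b K b< K<n Db ¬DK)) K≤b)
  ... | no ¬Db = proj₂ (lower a b (<-trans a<K K<n) b< (below a a<K) ¬Db)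

-- 3. The direct sum ⊕ and the child of a position

data Side (a : ℕ) : ℕ → Set where
  left  : ∀ {k} → k < a → Side a k
  right : ∀ k → Side a (a + k)

side : ∀ a k → Side a k
side a k with k <? a
... | yes k<a = left k<a
... | no  k≮a = subst (Side a) (m+[n∸m]≡n (≮⇒≥ k≮a)) (right (k ∸ a))

childIdx-left : (σ : List ℕ) (σs : List (List ℕ)) {k : ℕ} → k < length σ → childIdx (σ ∷ σs) k ≡ 0
childIdx-left σ σs {k} k< with k <ᵇ length σ | <⇒<ᵇ k<
... | true | _ = refl

childIdx-right : (σ : List ℕ) (σs : List (List ℕ)) (k : ℕ) →
  childIdx (σ ∷ σs) (length σ + k) ≡ suc (childIdx σs k)
childIdx-right σ σs k with (length σ + k) <ᵇ length σ in eq
... | true  = ⊥-elim (<⇒≱ (<ᵇ⇒< (length σ + k) (length σ) (subst T (sym eq) tt)) (m≤m+n (length σ) k))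
... | false = cong (λ z → suc (childIdx σs z)) (m+n∸m≡n (length σ) k)

module DirectSum (σ : List ℕ) (σs : List (List ℕ)) where

  length-⊕ : length (⊕ (σ ∷ σs)) ≡ length σ + length (⊕ σs)
  length-⊕ = trans (length-++ σ) (cong (length σ +_) (length-map (length σ +_) (⊕ σs)))

  at-left : ∀ {k} → k < length σ → at (⊕ (σ ∷ σs)) k ≡ at σ k
  at-left {k} k< = at-++ˡ σ _ k k<

  at-right : ∀ k → k < length (⊕ σs) → at (⊕ (σ ∷ σs)) (length σ + k) ≡ length σ + at (⊕ σs) k
  at-right k k< = trans (at-++ʳ σ _ k) (at-map (length σ +_) (⊕ σs) k k<)

  left< : ∀ {k} → k < length σ → k < length (⊕ (σ ∷ σs))
  left< k< = subst (_ <_) (sym length-⊕) (<-≤-trans k< (m≤m+n _ _))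

  right< : ∀ k → k < length (⊕ σs) → length σ + k < length (⊕ (σ ∷ σs))
  right< k k< = subst (_ <_) (sym length-⊕) (+-monoʳ-< (length σ) k<)

  right<⁻ : ∀ k → length σ + k < length (⊕ (σ ∷ σs)) → k < length (⊕ σs)
  right<⁻ k lt = +-cancelˡ-< (length σ) k _ (subst (length σ + k <_) length-⊕ lt)

open DirectSum

⊕-ordered : (ξs : List (List ℕ)) → All IndecomposableBlock ξs → ∀ k l →
  k < length (⊕ ξs) → l < length (⊕ ξs) →
  childIdx ξs k < childIdx ξs l → k < l × at (⊕ ξs) k < at (⊕ ξs) l
⊕-ordered (σ ∷ σs) ((σ-perm , _) ∷ bs) k l k< l< c< with side (length σ) k | side (length σ) l
... | left a | left b = ⊥-elim (<-irrefl (trans (childIdx-left σ σs a) (sym (childIdx-left σ σs b))) c<)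
... | left a | right l' =
  <-≤-trans a (m≤m+n _ _) ,
  subst₂ _<_ (sym (at-left σ σs a)) (sym (at-right σ σs l' (right<⁻ σ σs l' l<)))
    (<-≤-trans (PermutationOf.bounded σ _ σ-perm k a) (m≤m+n _ _))
... | right k' | left b = ⊥-elim (<⇒≱ (subst₂ _<_ (childIdx-right σ σs k') (childIdx-left σ σs b) c<) z≤n)
... | right k' | right l'
  with ⊕-ordered σs bs k' l' (right<⁻ σ σs k' k<) (right<⁻ σ σs l' l<)
         (≤-pred (subst₂ _<_ (childIdx-right σ σs k') (childIdx-right σ σs l') c<))
... | k'<l' , v< =
  +-monoʳ-< (length σ) k'<l' ,
  subst₂ _<_ (sym (at-right σ σs k' (right<⁻ σ σs k' k<))) (sym (at-right σ σs l' (right<⁻ σ σs l' l<)))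
    (+-monoʳ-< (length σ) v<)

⊕-injective : (ξs : List (List ℕ)) → All IndecomposableBlock ξs → ∀ k l →
  k < length (⊕ ξs) → l < length (⊕ ξs) → at (⊕ ξs) k ≡ at (⊕ ξs) l → k ≡ l
⊕-injective (σ ∷ σs) ((σ-perm , _) ∷ bs) k l k< l< e with side (length σ) k | side (length σ) l
... | left a | left b =
  PermutationOf.injective σ _ σ-perm k l a b (trans (sym (at-left σ σs a)) (trans e (at-left σ σs b)))
... | left a | right l' = ⊥-elim (<⇒≱ (<-≤-trans (PermutationOf.bounded σ _ σ-perm k a) (m≤m+n _ _))
  (≤-reflexive (trans (sym (at-right σ σs l' (right<⁻ σ σs l' l<))) (trans (sym e) (at-left σ σs a)))))
... | right k' | left b = ⊥-elim (<⇒≱ (<-≤-trans (PermutationOf.bounded σ _ σ-perm l b) (m≤m+n _ _))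
  (≤-reflexive (trans (sym (at-right σ σs k' (right<⁻ σ σs k' k<))) (trans e (at-left σ σs b)))))
... | right k' | right l' = cong (length σ +_) (⊕-injective σs bs k' l' (right<⁻ σ σs k' k<) (right<⁻ σ σs l' l<)
  (+-cancelˡ-≡ (length σ) _ _
    (trans (sym (at-right σ σs k' (right<⁻ σ σs k' k<))) (trans e (at-right σ σs l' (right<⁻ σ σs l' l<))))))

childIdx-bounded : (ξs : List (List ℕ)) → ∀ k → k < length (⊕ ξs) → childIdx ξs k < length ξs
childIdx-bounded (σ ∷ σs) k k< with side (length σ) k
... | left a   = subst (_< suc (length σs)) (sym (childIdx-left σ σs a)) (s≤s z≤n)
... | right k' = subst (_< suc (length σs)) (sym (childIdx-right σ σs k'))
                   (s≤s (childIdx-bounded σs k' (right<⁻ σ σs k' k<)))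

child-inhabited : (ξs : List (List ℕ)) → All IndecomposableBlock ξs →
  ∀ j → j < length ξs → ∃ λ k → k < length (⊕ ξs) × childIdx ξs k ≡ j
child-inhabited (σ ∷ σs) ((_ , _ , 0<|σ|) ∷ bs) zero _ = 0 , left< σ σs 0<|σ| , childIdx-left σ σs 0<|σ|
child-inhabited (σ ∷ σs) (_ ∷ bs) (suc j) (s≤s j<) with child-inhabited σs bs j j<
... | k , k< , e = length σ + k , right< σ σs k k< , trans (childIdx-right σ σs k) (cong suc e)

singleton-child : (ξs : List (List ℕ)) → All IndecomposableBlock ξs → ∀ j → j < length ξs →
  (∀ k l → k < length (⊕ ξs) → l < length (⊕ ξs) → childIdx ξs k ≡ j → childIdx ξs l ≡ j → k ≡ l) →
  childSize ξs j ≡ 1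
singleton-child (σ ∷ σs) ((_ , _ , 0<|σ|) ∷ bs) zero _ lone with length σ ≟ 1
... | yes e = e
... | no ne = ⊥-elim (0≢1+n (lone 0 1 (left< σ σs 0<|σ|) (left< σ σs 1<|σ|)
                      (childIdx-left σ σs 0<|σ|) (childIdx-left σ σs 1<|σ|)))
  where
  1<|σ| : 1 < length σ
  1<|σ| = ≤∧≢⇒< 0<|σ| (λ e → ne (sym e))
singleton-child (σ ∷ σs) (_ ∷ bs) (suc j) (s≤s j<) lone = singleton-child σs bs j j< lone'
  where
  lone' : ∀ k l → k < length (⊕ σs) → l < length (⊕ σs) → childIdx σs k ≡ j → childIdx σs l ≡ j → k ≡ l
  lone' k l k< l< ck cl = +-cancelˡ-≡ (length σ) k l
    (lone (length σ + k) (length σ + l) (right< σ σs k k<) (right< σ σs l l<)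
      (trans (childIdx-right σ σs k) (cong suc ck)) (trans (childIdx-right σ σs l) (cong suc cl)))

⊕-child-no-lower-left-part : (ξs : List (List ℕ)) → All IndecomposableBlock ξs → ∀ j →
  (D : ℕ → Set) → (∀ k → Dec (D k)) →
  ∀ k₀ l₀ → k₀ < length (⊕ ξs) → l₀ < length (⊕ ξs) → childIdx ξs k₀ ≡ j → childIdx ξs l₀ ≡ j →
  D k₀ → ¬ D l₀ →
  ¬ (∀ k l → k < length (⊕ ξs) → l < length (⊕ ξs) → childIdx ξs k ≡ j → childIdx ξs l ≡ j →
       D k → ¬ D l → k < l × at (⊕ ξs) k < at (⊕ ξs) l)
⊕-child-no-lower-left-part (σ ∷ σs) ((_ , indec , _) ∷ bs) zero D D? k₀ l₀ k₀< l₀< ck cl Dk₀ ¬Dl₀ lower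
  with side (length σ) k₀ | side (length σ) l₀
... | right k' | _        = 0≢1+n (trans (sym ck) (childIdx-right σ σs k'))
... | left _   | right l' = 0≢1+n (trans (sym cl) (childIdx-right σ σs l'))
... | left a   | left b   = no-lower-left-part σ indec D D? k₀ l₀ a b Dk₀ ¬Dl₀ lower'
  where
  lower' : ∀ k l → k < length σ → l < length σ → D k → ¬ D l → k < l × at σ k < at σ l
  lower' k l k< l< Dk ¬Dl with lower k l (left< σ σs k<) (left< σ σs l<)
                                  (childIdx-left σ σs k<) (childIdx-left σ σs l<) Dk ¬Dl
  ... | k<l , v< = k<l , subst₂ _<_ (at-left σ σs k<) (at-left σ σs l<) v<
⊕-child-no-lower-left-part (σ ∷ σs) (_ ∷ bs) (suc j) D D? k₀ l₀ k₀< l₀< ck cl Dk₀ ¬Dl₀ lower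
  with side (length σ) k₀ | side (length σ) l₀
... | left a   | _       = 0≢1+n (trans (sym (childIdx-left σ σs a)) ck)
... | right _  | left b  = 0≢1+n (trans (sym (childIdx-left σ σs b)) cl)
... | right k' | right l' =
  ⊕-child-no-lower-left-part σs bs j (λ k → D (length σ + k)) (λ k → D? (length σ + k)) k' l'
    (right<⁻ σ σs k' k₀<) (right<⁻ σ σs l' l₀<)
    (suc-injective (trans (sym (childIdx-right σ σs k')) ck))
    (suc-injective (trans (sym (childIdx-right σ σs l')) cl))
    Dk₀ ¬Dl₀ lower'
  where
  lower' : ∀ k l → k < length (⊕ σs) → l < length (⊕ σs) → childIdx σs k ≡ j → childIdx σs l ≡ j →
     D (length σ + k) → ¬ D (length σ + l) → k < l × at (⊕ σs) k < at (⊕ σs) l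
  lower' k l k< l< ck' cl' Dk ¬Dl
    with lower (length σ + k) (length σ + l) (right< σ σs k k<) (right< σ σs l l<)
               (trans (childIdx-right σ σs k) (cong suc ck')) (trans (childIdx-right σ σs l) (cong suc cl')) Dk ¬Dl
  ... | k<l , v< = +-cancelˡ-< (length σ) k l k<l ,
                   +-cancelˡ-< (length σ) _ _ (subst₂ _<_ (at-right σ σs k k<) (at-right σ σs l l<) v<)

-- 4. Geometry of pin sequences
-- The i-th point of a sequence has coordinates (X i , Y i).

BelowLeft : (X Y : ℕ → ℕ) → ℕ → ℕ → Set
BelowLeft X Y s u = X s < X u × Y s < Y u

<-by-exclusion : ∀ {a b} → a ≢ b → ¬ (b < a) → a < b
<-by-exclusion a≢b b≮a = ≤∧≢⇒< (≮⇒≥ b≮a) a≢b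

module PinGeometry (n : ℕ) (X Y : ℕ → ℕ)
  (injX : ∀ s u → s < n → u < n → X s ≡ X u → s ≡ u)
  (injY : ∀ s u → s < n → u < n → Y s ≡ Y u → s ≡ u)
  (pin : IsPinSeq X Y n) where

  _◁_ : ℕ → ℕ → Set
  _◁_ = BelowLeft X Y

  -- a pin leaves the bounding box of the earlier points, so it is never
  -- below-left of one earlier point and above-right of another
  not-between : ∀ s u t → s < t → u < t → t < n → s ◁ t → t ◁ u → ⊥
  not-between s u (suc i) s<t u<t t<n (xs , ys) (xu , yu) with proj₁ (pin i t<n)
  ... | inj₁ right-of-all                 = <-asym (right-of-all u u<t) xu
  ... | inj₂ (inj₁ left-of-all)           = <-asym (left-of-all s s<t) xs
  ... | inj₂ (inj₂ (inj₁ above-all))      = <-asym (above-all u u<t) yu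
  ... | inj₂ (inj₂ (inj₂ below-all))      = <-asym (below-all s s<t) ys

  distinct : ∀ {s u} → s < u → u < n → X s ≢ X u × Y s ≢ Y u
  distinct {s} {u} s<u u<n =
    (λ e → <-irrefl (injX s u (<-trans s<u u<n) u<n e) s<u) ,
    (λ e → <-irrefl (injY s u (<-trans s<u u<n) u<n e) s<u)

  noSplit-above : ∀ i → suc i < n → NoSplit X Y (suc i) → ∀ w → w < suc i → w ◁ suc i →
    ∀ s → s < suc i → s ◁ suc i
  noSplit-above i si<n (noSplitX , noSplitY) w w< (xw , yw) s s< =
    <-by-exclusion (proj₁ (distinct s< si<n)) (λ c → noSplitX (w , s , w< , s< , xw , c)) ,
    <-by-exclusion (proj₂ (distinct s< si<n)) (λ c → noSplitY (w , s , w< , s< , yw , c))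

  noSplit-below : ∀ i → suc i < n → NoSplit X Y (suc i) → ∀ w → w < suc i → suc i ◁ w →
    ∀ s → s < suc i → suc i ◁ s
  noSplit-below i si<n (noSplitX , noSplitY) w w< (xw , yw) s s< =
    <-by-exclusion (λ e → proj₁ (distinct s< si<n) (sym e)) (λ c → noSplitX (s , w , s< , w< , c , xw)) ,
    <-by-exclusion (λ e → proj₂ (distinct s< si<n) (sym e)) (λ c → noSplitY (s , w , s< , w< , c , yw))

  -- If some point z < i is below-left of pin suc i, then all points s < i are:
  -- the pin escapes to the right or to the top, and either separates point i
  -- from the earlier ones (on the far side of them) or splits nothing.
  pin-above : ∀ i z → suc i < n → z < i → z ◁ suc i → ∀ s → s < i → s ◁ suc i
  pin-above i z si<n z<i (xz , yz) s s<i with pin i si<n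
  ... | _ , inj₂ noSplit = noSplit-above i si<n noSplit z (m<n⇒m<1+n z<i) (xz , yz) s (m<n⇒m<1+n s<i)
  ... | inj₂ (inj₁ left-of-all)      , _ = ⊥-elim (<-asym (left-of-all z (m<n⇒m<1+n z<i)) xz)
  ... | inj₂ (inj₂ (inj₂ below-all)) , _ = ⊥-elim (<-asym (below-all z (m<n⇒m<1+n z<i)) yz)
  ... | _ , inj₁ (inj₁ (_ , g))               = ⊥-elim (<-asym (g z z<i) xz)
  ... | _ , inj₁ (inj₂ (inj₂ (inj₁ (_ , g)))) = ⊥-elim (<-asym (g z z<i) yz)
  ... | inj₁ right-of-all , inj₁ (inj₂ (inj₁ (left-of-i , _))) = ⊥-elim (<-asym left-of-i (right-of-all i (n<1+n i)))
  ... | inj₁ right-of-all , inj₁ (inj₂ (inj₂ (inj₂ (_ , g)))) = right-of-all s (m<n⇒m<1+n s<i) , g s s<i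
  ... | inj₂ (inj₂ (inj₁ above-all)) , inj₁ (inj₂ (inj₁ (_ , g))) = g s s<i , above-all s (m<n⇒m<1+n s<i)
  ... | inj₂ (inj₂ (inj₁ above-all)) , inj₁ (inj₂ (inj₂ (inj₂ (below-i , _)))) =
    ⊥-elim (<-asym below-i (above-all i (n<1+n i)))

  pin-below : ∀ i z → suc i < n → z < i → suc i ◁ z → ∀ s → s < i → suc i ◁ s
  pin-below i z si<n z<i (xz , yz) s s<i with pin i si<n
  ... | _ , inj₂ noSplit = noSplit-below i si<n noSplit z (m<n⇒m<1+n z<i) (xz , yz) s (m<n⇒m<1+n s<i)
  ... | inj₁ right-of-all            , _ = ⊥-elim (<-asym (right-of-all z (m<n⇒m<1+n z<i)) xz)
  ... | inj₂ (inj₂ (inj₁ above-all)) , _ = ⊥-elim (<-asym (above-all z (m<n⇒m<1+n z<i)) yz)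
  ... | _ , inj₁ (inj₂ (inj₁ (_ , g)))        = ⊥-elim (<-asym (g z z<i) xz)
  ... | _ , inj₁ (inj₂ (inj₂ (inj₂ (_ , g)))) = ⊥-elim (<-asym (g z z<i) yz)
  ... | inj₂ (inj₁ left-of-all) , inj₁ (inj₁ (right-of-i , _)) = ⊥-elim (<-asym right-of-i (left-of-all i (n<1+n i)))
  ... | inj₂ (inj₁ left-of-all) , inj₁ (inj₂ (inj₂ (inj₁ (_ , g)))) = left-of-all s (m<n⇒m<1+n s<i) , g s s<i
  ... | inj₂ (inj₂ (inj₂ below-all)) , inj₁ (inj₁ (_ , g)) = g s s<i , below-all s (m<n⇒m<1+n s<i)
  ... | inj₂ (inj₂ (inj₂ below-all)) , inj₁ (inj₂ (inj₂ (inj₁ (above-i , _)))) =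
    ⊥-elim (<-asym above-i (below-all i (n<1+n i)))

-- 5. The order in which a pin sequence reads the children
-- Abstractly: n points with coordinates X, Y, the t-th point belonging to child C t
-- among r children; points of lower children lie below-left of points of higher ones.

ReadApartUp : (n : ℕ) (X Y C : ℕ → ℕ) → ℕ → ℕ → Set
ReadApartUp n X Y C t₀ j = ∀ s u → s < t₀ → t₀ ≤ u → u < n → C s ≡ j → C u ≡ j → BelowLeft X Y s u

ReadApartDown : (n : ℕ) (X Y C : ℕ → ℕ) → ℕ → ℕ → Set
ReadApartDown n X Y C t₀ j = ∀ s u → s < t₀ → t₀ ≤ u → u < n → C s ≡ j → C u ≡ j → BelowLeft X Y u s

module Reading (n : ℕ) (X Y C : ℕ → ℕ) (r : ℕ)
  (injX : ∀ s u → s < n → u < n → X s ≡ X u → s ≡ u)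
  (injY : ∀ s u → s < n → u < n → Y s ≡ Y u → s ≡ u)
  (pin : IsPinSeq X Y n)
  (ordered : ∀ s u → s < n → u < n → C s < C u → BelowLeft X Y s u)
  (C-bounded : ∀ s → s < n → C s < r)
  (C-onto : ∀ j → j < r → ∃ λ t → t < n × C t ≡ j)
  -- children are indecomposable: a child read both before and after t₀ is not read apart
  (not-apart-up : ∀ t₀ j s₀ u₀ → s₀ < t₀ → t₀ ≤ u₀ → u₀ < n → C s₀ ≡ j → C u₀ ≡ j →
     ¬ ReadApartUp n X Y C t₀ j)
  (not-apart-down : ∀ t₀ j s₀ u₀ → s₀ < t₀ → t₀ ≤ u₀ → u₀ < n → C s₀ ≡ j → C u₀ ≡ j →
     ¬ ReadApartDown n X Y C t₀ j)
  where

  open PinGeometry n X Y injX injY pin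

  child-not-between : ∀ s u t → s < t → u < t → t < n → C s < C t → C t < C u → ⊥
  child-not-between s u t s<t u<t t<n cs ct =
    not-between s u t s<t u<t t<n (ordered s t (<-trans s<t t<n) t<n cs) (ordered t u t<n (<-trans u<t t<n) ct)

  stays-above : ∀ t₀ j z → (∀ s → s < t₀ → s ◁ t₀) → z < t₀ → C z < j →
    ∀ s u → s < t₀ → t₀ ≤ u → u < n → C u ≡ j → s ◁ u
  stays-above t₀ j z above z<t₀ cz s u s<t₀ t₀≤u u<n cu with m≤n⇒m<n∨m≡n t₀≤u
  ... | inj₂ refl = above s s<t₀
  stays-above t₀ j z above z<t₀ cz s (suc i) s<t₀ t₀≤u u<n cu | inj₁ t₀<u =
    pin-above i z u<n z<i (ordered z (suc i) z<n u<n (subst (C z <_) (sym cu) cz)) s (<-≤-trans s<t₀ t₀≤i)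
    where
    t₀≤i = ≤-pred t₀<u
    z<i  = <-≤-trans z<t₀ t₀≤i
    z<n  = <-trans z<i (<-trans (n<1+n i) u<n)

  stays-below : ∀ t₀ j z → (∀ s → s < t₀ → t₀ ◁ s) → z < t₀ → j < C z →
    ∀ s u → s < t₀ → t₀ ≤ u → u < n → C u ≡ j → u ◁ s
  stays-below t₀ j z below z<t₀ cz s u s<t₀ t₀≤u u<n cu with m≤n⇒m<n∨m≡n t₀≤u
  ... | inj₂ refl = below s s<t₀
  stays-below t₀ j z below z<t₀ cz s (suc i) s<t₀ t₀≤u u<n cu | inj₁ t₀<u =
    pin-below i z u<n z<i (ordered (suc i) z u<n z<n (subst (_< C z) (sym cu) cz)) s (<-≤-trans s<t₀ t₀≤i)
    where
    t₀≤i = ≤-pred t₀<u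
    z<i  = <-≤-trans z<t₀ t₀≤i
    z<n  = <-trans z<i (<-trans (n<1+n i) u<n)

  -- Re-entering an already visited child j at suc i from a higher (resp. lower)
  -- child i is possible only if no earlier point belongs to a child above
  -- (resp. below) j: a separating pin would have to lie beyond such a point, and
  -- a pin splitting nothing would read child j apart.
  reentry-from-above : ∀ i j s₀ → suc i < n → C (suc i) ≡ j → j < C i → s₀ < i → C s₀ ≡ j →
    ∀ k → k < i → ¬ (j < C k)
  reentry-from-above i j s₀ si<n cs j<ci s₀<i cs₀ k k<i j<ck = by-cases (proj₂ (pin i si<n))
    where
    i<n  = <-trans (n<1+n i) si<n
    si◁i = ordered (suc i) i si<n i<n (subst (_< C i) (sym cs) j<ci)
    si◁k = ordered (suc i) k si<n (<-trans k<i i<n) (subst (_< C k) (sym cs) j<ck)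
    by-cases : SepPrev X Y i ⊎ NoSplit X Y (suc i) → ⊥
    by-cases (inj₁ (inj₁ (right-of-i , _)))             = <-asym right-of-i (proj₁ si◁i)
    by-cases (inj₁ (inj₂ (inj₁ (_ , g))))               = <-asym (g k k<i) (proj₁ si◁k)
    by-cases (inj₁ (inj₂ (inj₂ (inj₁ (above-i , _))))) = <-asym above-i (proj₂ si◁i)
    by-cases (inj₁ (inj₂ (inj₂ (inj₂ (_ , g)))))       = <-asym (g k k<i) (proj₂ si◁k)
    by-cases (inj₂ noSplit) =
      not-apart-down (suc i) j s₀ (suc i) (m<n⇒m<1+n s₀<i) ≤-refl si<n cs₀ cs
        (λ s u s< le u< _ cu → stays-below (suc i) j i (noSplit-below i si<n noSplit i (n<1+n i) si◁i)
                                 (n<1+n i) j<ci s u s< le u< cu)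

  reentry-from-below : ∀ i j s₀ → suc i < n → C (suc i) ≡ j → C i < j → s₀ < i → C s₀ ≡ j →
    ∀ k → k < i → ¬ (C k < j)
  reentry-from-below i j s₀ si<n cs ci<j s₀<i cs₀ k k<i ck<j = by-cases (proj₂ (pin i si<n))
    where
    i<n  = <-trans (n<1+n i) si<n
    i◁si = ordered i (suc i) i<n si<n (subst (C i <_) (sym cs) ci<j)
    k◁si = ordered k (suc i) (<-trans k<i i<n) si<n (subst (C k <_) (sym cs) ck<j)
    by-cases : SepPrev X Y i ⊎ NoSplit X Y (suc i) → ⊥
    by-cases (inj₁ (inj₁ (_ , g)))                       = <-asym (g k k<i) (proj₁ k◁si)
    by-cases (inj₁ (inj₂ (inj₁ (left-of-i , _))))       = <-asym left-of-i (proj₁ i◁si)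
    by-cases (inj₁ (inj₂ (inj₂ (inj₁ (_ , g)))))        = <-asym (g k k<i) (proj₂ k◁si)
    by-cases (inj₁ (inj₂ (inj₂ (inj₂ (below-i , _))))) = <-asym below-i (proj₂ i◁si)
    by-cases (inj₂ noSplit) =
      not-apart-up (suc i) j s₀ (suc i) (m<n⇒m<1+n s₀<i) ≤-refl si<n cs₀ cs
        (λ s u s< le u< _ cu → stays-above (suc i) j i (noSplit-above i si<n noSplit i (n<1+n i) i◁si)
                                 (n<1+n i) ci<j s u s< le u< cu)

  -- Part A: a child j other than the first one read is never re-entered.
  -- Re-entering it from below puts every earlier child, in particular C 0, above j,
  -- so pin suc i would lie between points i and 0; symmetrically from above.
  not-reentered : ∀ j i s → j ≢ C 0 → suc i < n → C (suc i) ≡ j → C i ≢ j → s < i → C s ≡ j → ⊥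
  not-reentered j i s j≢c0 si<n cs ci≢j s<i css with <-cmp (C i) j
  ... | tri≈ _ e _ = ci≢j e
  ... | tri< ci<j _ _ =
    child-not-between i 0 (suc i) (n<1+n i) (s≤s z≤n) si<n (subst (C i <_) (sym cs) ci<j)
      (subst (_< C 0) (sym cs) (≤∧≢⇒< (≮⇒≥ (reentry-from-below i j s si<n cs ci<j s<i css 0 0<i)) j≢c0))
    where 0<i = ≤-<-trans z≤n s<i
  ... | tri> _ _ j<ci =
    child-not-between 0 i (suc i) (s≤s z≤n) (n<1+n i) si<n
      (subst (C 0 <_) (sym cs) (≤∧≢⇒< (≮⇒≥ (reentry-from-above i j s si<n cs j<ci s<i css 0 0<i)) (≢-sym j≢c0)))
      (subst (_< C i) (sym cs) j<ci)
    where 0<i = ≤-<-trans z≤n s<i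

  record Departure (m : ℕ) : Set where
    field
      adjacent      : suc (C m) ≡ C 0 ⊎ C m ≡ suc (C 0)
      first-closed  : ∀ i → m < i → suc i < n → C (suc i) ≡ C 0 → C i ≡ C 0
      second-closed : ∀ i → m < i → suc i < n → C (suc i) ≡ C m → C i ≡ C m

  -- Leaving upwards: a child strictly between C 0 and C m would be read after m,
  -- by a pin between the points 0 and m.  A later re-entry into C 0 (or C m)
  -- comes from below, putting a pin between two earlier children, or from
  -- above, which reentry-from-above forbids because of the point m (or 0).
  departure-up : ∀ m → m < n → (∀ l → l < m → C l ≡ C 0) → C 0 < C m → Departure m
  departure-up m m<n before up = record { adjacent = inj₂ adjacent ; first-closed = first-closed ; second-closed = second-closed }
    where
    adjacent : C m ≡ suc (C 0)
    adjacent with C m ≟ suc (C 0)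
    ... | yes e = e
    ... | no ne with C-onto (suc (C 0)) (<-trans (≤∧≢⇒< up (≢-sym ne)) (C-bounded m m<n))
    ...   | w , w<n , cw with <-cmp w m
    ...     | tri< w<m _ _   = ⊥-elim (1+n≢n (trans (sym cw) (before w w<m)))
    ...     | tri≈ _ refl _  = ⊥-elim (ne cw)
    ...     | tri> _ _ m<w   = ⊥-elim (child-not-between 0 m w (≤-<-trans z≤n m<w) m<w w<n
                                 (subst (C 0 <_) (sym cw) (n<1+n (C 0))) (subst (_< C m) (sym cw) (≤∧≢⇒< up (≢-sym ne))))
    first-closed : ∀ i → m < i → suc i < n → C (suc i) ≡ C 0 → C i ≡ C 0
    first-closed i m<i si<n cs with <-cmp (C i) (C 0)
    ... | tri≈ _ e _ = e
    ... | tri< a _ _ = ⊥-elim (child-not-between i m (suc i) (n<1+n i) (m<n⇒m<1+n m<i) si<n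
                                 (subst (C i <_) (sym cs) a) (subst (_< C m) (sym cs) up))
    ... | tri> _ _ c = ⊥-elim (reentry-from-above i (C 0) 0 si<n cs c (≤-<-trans z≤n m<i) refl m m<i up)
    second-closed : ∀ i → m < i → suc i < n → C (suc i) ≡ C m → C i ≡ C m
    second-closed i m<i si<n cs with <-cmp (C i) (C m)
    ... | tri≈ _ e _ = e
    ... | tri> _ _ c = ⊥-elim (child-not-between 0 i (suc i) (s≤s z≤n) (n<1+n i) si<n
                                 (subst (C 0 <_) (sym cs) up) (subst (_< C i) (sym cs) c))
    ... | tri< a _ _ = ⊥-elim (reentry-from-below i (C m) m si<n cs a m<i refl 0 (≤-<-trans z≤n m<i) up)

  departure-down : ∀ m → m < n → (∀ l → l < m → C l ≡ C 0) → C m < C 0 → Departure m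
  departure-down m m<n before down = record { adjacent = inj₁ adjacent ; first-closed = first-closed ; second-closed = second-closed }
    where
    adjacent : suc (C m) ≡ C 0
    adjacent with suc (C m) ≟ C 0
    ... | yes e = e
    ... | no ne with C-onto (suc (C m)) (<-trans (≤∧≢⇒< down ne) (C-bounded 0 (≤-<-trans z≤n m<n)))
    ...   | w , w<n , cw with <-cmp w m
    ...     | tri< w<m _ _   = ⊥-elim (ne (trans (sym cw) (before w w<m)))
    ...     | tri≈ _ refl _  = ⊥-elim (1+n≢n (sym cw))
    ...     | tri> _ _ m<w   = ⊥-elim (child-not-between m 0 w m<w (≤-<-trans z≤n m<w) w<n
                                 (subst (C m <_) (sym cw) (n<1+n (C m))) (subst (_< C 0) (sym cw) (≤∧≢⇒< down ne)))
    first-closed : ∀ i → m < i → suc i < n → C (suc i) ≡ C 0 → C i ≡ C 0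
    first-closed i m<i si<n cs with <-cmp (C i) (C 0)
    ... | tri≈ _ e _ = e
    ... | tri> _ _ c = ⊥-elim (child-not-between m i (suc i) (m<n⇒m<1+n m<i) (n<1+n i) si<n
                                 (subst (C m <_) (sym cs) down) (subst (_< C i) (sym cs) c))
    ... | tri< a _ _ = ⊥-elim (reentry-from-below i (C 0) 0 si<n cs a (≤-<-trans z≤n m<i) refl m m<i down)
    second-closed : ∀ i → m < i → suc i < n → C (suc i) ≡ C m → C i ≡ C m
    second-closed i m<i si<n cs with <-cmp (C i) (C m)
    ... | tri≈ _ e _ = e
    ... | tri< a _ _ = ⊥-elim (child-not-between i 0 (suc i) (n<1+n i) (s≤s z≤n) si<n
                                 (subst (C i <_) (sym cs) a) (subst (_< C 0) (sym cs) down))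
    ... | tri> _ _ c = ⊥-elim (reentry-from-above i (C m) m si<n cs c m<i refl 0 (≤-<-trans z≤n m<i) down)

  propagate-back : ∀ m j → (∀ i → m < i → suc i < n → C (suc i) ≡ j → C i ≡ j) →
    ∀ t → m < t → t < n → C t ≡ j → C (suc m) ≡ j
  propagate-back m j closed (suc t) m<st st<n ct with m≤n⇒m<n∨m≡n (≤-pred m<st)
  ... | inj₂ refl = ct
  ... | inj₁ m<t  = propagate-back m j closed t m<t (<-trans (n<1+n t) st<n) (closed t m<t st<n ct)

  record SecondChild : Set where
    field
      m         : ℕ
      m+1<n     : suc m < n
      before    : ∀ l → l < m → C l ≡ C 0
      leaves    : C m ≢ C 0
      adjacent  : suc (C m) ≡ C 0 ⊎ C m ≡ suc (C 0)
      lone      : ∀ t → t < n → C t ≡ C m → t ≡ m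
      no-return : ∀ i → m < i → suc i < n → C (suc i) ≡ C 0 → C i ≡ C 0

  -- A return to C 0 at suc i, after a first departure at m ≤ i: the point m is
  -- alone in its child, since the reading is back in C 0 at suc m and can
  -- re-enter neither child afterwards.
  second-child-at : ∀ i m → m < suc i → suc i < n → C (suc i) ≡ C 0 →
    (∀ l → l < m → C l ≡ C 0) → C m ≢ C 0 → SecondChild
  second-child-at i m m<si si<n returns before leaves = record
    { m = m ; m+1<n = m+1<n ; before = before ; leaves = leaves
    ; adjacent = adjacent ; lone = lone ; no-return = first-closed }
    where
    m+1<n : suc m < n
    m+1<n = ≤-<-trans m<si si<n
    departure : Departure m
    departure with <-cmp (C m) (C 0)
    ... | tri< down _ _ = departure-down m (<-trans (n<1+n m) m+1<n) before down
    ... | tri≈ _ e _    = ⊥-elim (leaves e)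
    ... | tri> _ _ up   = departure-up m (<-trans (n<1+n m) m+1<n) before up
    open Departure departure
    back-at-m+1 : C (suc m) ≡ C 0
    back-at-m+1 = propagate-back m (C 0) first-closed (suc i) m<si si<n returns
    lone : ∀ t → t < n → C t ≡ C m → t ≡ m
    lone t t<n ct with <-cmp t m
    ... | tri< t<m _ _ = ⊥-elim (leaves (trans (sym ct) (before t t<m)))
    ... | tri≈ _ t≡m _ = t≡m
    ... | tri> _ _ m<t = ⊥-elim (leaves (trans (sym (propagate-back m (C m) second-closed t m<t t<n ct)) back-at-m+1))

  second-child : ∀ i → suc i < n → C (suc i) ≡ C 0 → C i ≢ C 0 → SecondChild
  second-child i si<n returns ci≢c0 with first-failure (λ l → C l ≡ C 0) (λ l → C l ≟ C 0) (suc i)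
  ... | inj₁ all = ⊥-elim (ci≢c0 (all i (n<1+n i)))
  ... | inj₂ (m , m<si , leaves , before) = second-child-at i m m<si si<n returns before leaves

  unique-return : (sc : SecondChild) → ∀ i → suc i < n → C (suc i) ≡ C 0 → C i ≢ C 0 → i ≡ SecondChild.m sc
  unique-return sc i si<n cs ci≢c0 = by-cases (<-cmp i m)
    where
    open SecondChild sc
    by-cases : Tri (i < m) (i ≡ m) (m < i) → i ≡ m
    by-cases (tri< i<m _ _) = ⊥-elim (ci≢c0 (before i i<m))
    by-cases (tri≈ _ i≡m _) = i≡m
    by-cases (tri> _ _ m<i) = ⊥-elim (ci≢c0 (no-return i m<i si<n cs))

-- 6. Counting the pieces of a reading

first-rise : (f : ℕ → Bool) → ∀ t → f 0 ≡ false → f t ≡ true →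
  ∃ λ i → suc i ≤ t × f i ≡ false × f (suc i) ≡ true
first-rise f zero    f0 ft = ⊥-elim (false≢true (trans (sym f0) ft))
  where
  false≢true : false ≢ true
  false≢true ()
first-rise f (suc t) f0 ft with f t in ft'
... | false = t , ≤-refl , ft' , ft
... | true with first-rise f t f0 ft'
...   | i , i<t , rise = i , m≤n⇒m≤1+n i<t , rise

module Pieces (d : ℕ → Bool) where

  EntersAt : List ℕ → ℕ → Set
  EntersAt xs i = suc i < length xs × d (at xs i) ≡ false × d (at xs (suc i)) ≡ true

  shift : ∀ x xs {i} → EntersAt xs i → EntersAt (x ∷ xs) (suc i)
  shift _ _ (si< , out , inside) = s≤s si< , out , inside

  piece-member : ∀ b xs → 1 ≤ piecesFrom d b xs → ∃ λ t → t < length xs × d (at xs t) ≡ true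
  piece-member b (x ∷ xs) h with d x in dx
  ... | true  = 0 , s≤s z≤n , dx
  ... | false with piece-member false xs h
  ...   | t , t< , dt = suc t , s≤s t< , dt

  entry-from-inside : ∀ xs → 1 ≤ piecesFrom d true xs → ∃ λ i → EntersAt xs i
  entry-from-inside (x ∷ xs) h with d x in dx
  ... | true with entry-from-inside xs h
  ...   | i , entry = suc i , shift x xs entry
  entry-from-inside (x ∷ xs) h | false with piece-member false xs h
  ...   | t , t< , dt with first-rise (λ k → d (at (x ∷ xs) k)) (suc t) dx dt
  ...     | i , i≤t , rise = i , ≤-<-trans i≤t (s≤s t<) , rise

  second-piece : ∀ b xs → 2 ≤ piecesFrom d b xs →
    ∃ λ i → ∃ λ s → s < i × d (at xs s) ≡ true × EntersAt xs i
  second-piece b (x ∷ xs) h with d x in dx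
  ... | false with second-piece false xs h
  ...   | i , s , s<i , ds , entry = suc i , suc s , s≤s s<i , ds , shift x xs entry
  second-piece b (x ∷ xs) h | true with entry-from-inside xs (one-more b h)
    where
    one-more : ∀ b → 2 ≤ (if b then 0 else 1) + piecesFrom d true xs → 1 ≤ piecesFrom d true xs
    one-more true  h       = ≤-trans (s≤s z≤n) h
    one-more false (s≤s h) = h
  ...   | i , entry = suc i , 0 , s≤s z≤n , dx , shift x xs entry

  two-entries-from-inside : ∀ xs → 2 ≤ piecesFrom d true xs →
    ∃ λ i₁ → ∃ λ i₂ → i₁ < i₂ × EntersAt xs i₁ × EntersAt xs i₂
  two-entries-from-inside (x ∷ xs) h with d x in dx
  ... | true with two-entries-from-inside xs h
  ...   | i₁ , i₂ , i₁<i₂ , e₁ , e₂ = suc i₁ , suc i₂ , s≤s i₁<i₂ , shift x xs e₁ , shift x xs e₂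
  two-entries-from-inside (x ∷ xs) h | false with second-piece false xs h
  ...   | i , s , s<i , ds , e₂ with first-rise (λ k → d (at (x ∷ xs) k)) (suc s) dx ds
  ...     | i₁ , i₁≤s , rise =
    i₁ , suc i , m≤n⇒m≤1+n (≤-trans i₁≤s s<i) ,
    (s≤s (<-trans (≤-<-trans (≤-pred i₁≤s) s<i) (<-trans (n<1+n i) (proj₁ e₂))) , rise) , shift x xs e₂

  third-piece : ∀ b xs → 3 ≤ piecesFrom d b xs →
    ∃ λ i₁ → ∃ λ i₂ → i₁ < i₂ × EntersAt xs i₁ × EntersAt xs i₂
  third-piece b (x ∷ xs) h with d x in dx
  ... | false with third-piece false xs h
  ...   | i₁ , i₂ , i₁<i₂ , e₁ , e₂ = suc i₁ , suc i₂ , s≤s i₁<i₂ , shift x xs e₁ , shift x xs e₂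
  third-piece b (x ∷ xs) h | true with two-entries-from-inside xs (two-more b h)
    where
    two-more : ∀ b → 3 ≤ (if b then 0 else 1) + piecesFrom d true xs → 2 ≤ piecesFrom d true xs
    two-more true  h       = ≤-trans (n≤1+n 2) h
    two-more false (s≤s h) = h
  ...   | i₁ , i₂ , i₁<i₂ , e₁ , e₂ = suc i₁ , suc i₂ , s≤s i₁<i₂ , shift x xs e₁ , shift x xs e₂

  first-piece : ∀ xs → 0 < length xs → d (at xs 0) ≡ true → 1 ≤ pieces d xs
  first-piece (x ∷ xs) _ dx with d x
  first-piece (x ∷ xs) _ refl | true = s≤s z≤n

-- 7. Pin representations of ⊕ ξs

≡ᵇ-true : ∀ a b → (a ≡ᵇ b) ≡ true → a ≡ b
≡ᵇ-true a b e = ≡ᵇ⇒≡ a b (subst T (sym e) tt)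

≡ᵇ-false : ∀ a b → (a ≡ᵇ b) ≡ false → a ≢ b
≡ᵇ-false a b e a≡b = subst T e (≡⇒≡ᵇ a b a≡b)

≡ᵇ-refl : ∀ a → (a ≡ᵇ a) ≡ true
≡ᵇ-refl zero    = refl
≡ᵇ-refl (suc a) = ≡ᵇ-refl a

∨-false : ∀ a b → (a ∨ b) ≡ false → a ≡ false × b ≡ false
∨-false false false _ = refl , refl

∨-true : ∀ a b → (a ∨ b) ≡ true → a ≡ true ⊎ b ≡ true
∨-true true  _ _ = inj₁ refl
∨-true false _ e = inj₂ e

read-before? : (p : List ℕ) (t₀ k : ℕ) → Dec (∃ λ s → s < t₀ × at p s ≡ k)
read-before? p zero    k = no (λ { (s , () , _) })
read-before? p (suc t₀) k with at p t₀ ≟ k | read-before? p t₀ k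
... | yes e | _                   = yes (t₀ , n<1+n t₀ , e)
... | no _  | yes (s , s< , e)    = yes (s , m<n⇒m<1+n s< , e)
... | no ne | no earlier          = no not-read
  where
  not-read : ¬ (∃ λ s → s < suc t₀ × at p s ≡ k)
  not-read (s , s< , e) with m≤n⇒m<n∨m≡n (≤-pred s<)
  ... | inj₁ s<t₀ = earlier (s , s<t₀ , e)
  ... | inj₂ refl = ne e

module PinRepresentation (ξs : List (List ℕ)) (incOsc : All IsIncOsc ξs)
  (p : List ℕ) (rep : IsPinRep (⊕ ξs) p) where

  π = ⊕ ξs
  n = length π

  blocks : All IndecomposableBlock ξs
  blocks = All-map (λ {σ} → incOsc⇒indecomposableBlock σ) incOsc

  open PermutationOf p n (proj₁ rep)

  X Y C : ℕ → ℕ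
  X t = at p t
  Y t = at π (at p t)
  C t = childIdx ξs (at p t)

  to-p : ∀ {t} → t < n → t < length p
  to-p {t} = subst (t <_) (sym length≡)

  from-p : ∀ {t} → t < length p → t < n
  from-p {t} = subst (t <_) length≡

  X<n : ∀ t → t < n → X t < n
  X<n t t<n = bounded t (to-p t<n)

  injX : ∀ s u → s < n → u < n → X s ≡ X u → s ≡ u
  injX s u s<n u<n = injective s u (to-p s<n) (to-p u<n)

  injY : ∀ s u → s < n → u < n → Y s ≡ Y u → s ≡ u
  injY s u s<n u<n e = injX s u s<n u<n (⊕-injective ξs blocks (X s) (X u) (X<n s s<n) (X<n u u<n) e)

  ordered : ∀ s u → s < n → u < n → C s < C u → BelowLeft X Y s u
  ordered s u s<n u<n = ⊕-ordered ξs blocks (X s) (X u) (X<n s s<n) (X<n u u<n)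

  C-bounded : ∀ s → s < n → C s < length ξs
  C-bounded s s<n = childIdx-bounded ξs (X s) (X<n s s<n)

  read-at : ∀ k → k < n → ∃ λ t → t < n × X t ≡ k
  read-at k k<n with surjective k k<n
  ... | t , t< , e = t , from-p t< , e

  C-onto : ∀ j → j < length ξs → ∃ λ t → t < n × C t ≡ j
  C-onto j j< with child-inhabited ξs blocks j j<
  ... | k , k<n , ck with read-at k k<n
  ...   | t , t<n , refl = t , t<n , ck

  ReadBefore : ℕ → ℕ → Set
  ReadBefore t₀ k = ∃ λ s → s < t₀ × at p s ≡ k

  not-read-before : ∀ t₀ u → t₀ ≤ u → u < n → ¬ ReadBefore t₀ (X u)
  not-read-before t₀ u t₀≤u u<n (s , s<t₀ , e) =
    <-irrefl (injX s u (<-≤-trans s<t₀ (≤-trans t₀≤u (<⇒≤ u<n))) u<n e) (<-≤-trans s<t₀ t₀≤u)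

  read-from : ∀ t₀ k → k < n → ¬ ReadBefore t₀ k → ∃ λ u → t₀ ≤ u × u < n × X u ≡ k
  read-from t₀ k k<n unread with read-at k k<n
  ... | u , u<n , e with t₀ ≤? u
  ...   | yes t₀≤u = u , t₀≤u , u<n , e
  ...   | no  t₀≰u = ⊥-elim (unread (u , ≰⇒> t₀≰u , e))

  -- Reading a child apart at t₀ would make the positions read before t₀ a
  -- lower-left (resp. upper-right) part of that child of ⊕.
  not-apart-up : ∀ t₀ j s₀ u₀ → s₀ < t₀ → t₀ ≤ u₀ → u₀ < n → C s₀ ≡ j → C u₀ ≡ j →
    ¬ ReadApartUp n X Y C t₀ j
  not-apart-up t₀ j s₀ u₀ s₀<t₀ t₀≤u₀ u₀<n cs cu apart =
    ⊕-child-no-lower-left-part ξs blocks j (ReadBefore t₀) (read-before? p t₀) (X s₀) (X u₀)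
      (X<n s₀ (<-≤-trans s₀<t₀ (≤-trans t₀≤u₀ (<⇒≤ u₀<n)))) (X<n u₀ u₀<n) cs cu
      (s₀ , s₀<t₀ , refl) (not-read-before t₀ u₀ t₀≤u₀ u₀<n) lower
    where
    lower : ∀ k l → k < n → l < n → childIdx ξs k ≡ j → childIdx ξs l ≡ j →
      ReadBefore t₀ k → ¬ ReadBefore t₀ l → k < l × at π k < at π l
    lower k l _ l<n ck cl (s , s<t₀ , refl) unread with read-from t₀ l l<n unread
    ... | u , t₀≤u , u<n , refl = apart s u s<t₀ t₀≤u u<n ck cl

  not-apart-down : ∀ t₀ j s₀ u₀ → s₀ < t₀ → t₀ ≤ u₀ → u₀ < n → C s₀ ≡ j → C u₀ ≡ j →
    ¬ ReadApartDown n X Y C t₀ j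
  not-apart-down t₀ j s₀ u₀ s₀<t₀ t₀≤u₀ u₀<n cs cu apart =
    ⊕-child-no-lower-left-part ξs blocks j (λ k → ¬ ReadBefore t₀ k) (λ k → ¬? (read-before? p t₀ k))
      (X u₀) (X s₀) (X<n u₀ u₀<n) (X<n s₀ (<-≤-trans s₀<t₀ (≤-trans t₀≤u₀ (<⇒≤ u₀<n)))) cu cs
      (not-read-before t₀ u₀ t₀≤u₀ u₀<n) (λ unread → unread (s₀ , s₀<t₀ , refl)) lower
    where
    lower : ∀ k l → k < n → l < n → childIdx ξs k ≡ j → childIdx ξs l ≡ j →
      ¬ ReadBefore t₀ k → ¬ ¬ ReadBefore t₀ l → k < l × at π k < at π l
    lower k l k<n _ ck cl unread read with decidable-stable (read-before? p t₀ l) read | read-from t₀ k k<n unread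
    ... | s , s<t₀ , refl | u , t₀≤u , u<n , refl = apart s u s<t₀ t₀≤u u<n cl ck

  open Reading n X Y C (length ξs) injX injY (proj₂ rep) ordered C-bounded C-onto not-apart-up not-apart-down
  open Pieces

  other-child-one-piece : ∀ j → j ≢ C 0 → pieces (inChild ξs j) p ≤ 1
  other-child-one-piece j j≢c0 with 2 ≤? pieces (inChild ξs j) p
  ... | no  ≱2 = ≤-pred (≰⇒> ≱2)
  ... | yes ≥2 with second-piece (inChild ξs j) false p ≥2
  ...   | i , s , s<i , in-s , (si< , out , back) =
    ⊥-elim (not-reentered j i s j≢c0 (from-p si<) (≡ᵇ-true _ _ back) (≡ᵇ-false _ _ out) s<i (≡ᵇ-true _ _ in-s))

  module _ (sc : SecondChild) where
    open SecondChild sc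

    -- a third piece of C 0 would need a second return to C 0
    first-child-two-pieces : pieces (inChild ξs (C 0)) p ≤ 2
    first-child-two-pieces with 3 ≤? pieces (inChild ξs (C 0)) p
    ... | no  ≱3 = ≤-pred (≰⇒> ≱3)
    ... | yes ≥3 with third-piece (inChild ξs (C 0)) false p ≥3
    ...   | i₁ , i₂ , i₁<i₂ , (si₁< , out₁ , back₁) , (si₂< , out₂ , back₂) =
      ⊥-elim (<-irrefl (trans (unique-return sc i₁ (from-p si₁<) (≡ᵇ-true _ _ back₁) (≡ᵇ-false _ _ out₁))
                              (sym (unique-return sc i₂ (from-p si₂<) (≡ᵇ-true _ _ back₂) (≡ᵇ-false _ _ out₂)))) i₁<i₂)

    second-child-singleton : childSize ξs (C m) ≡ 1
    second-child-singleton = singleton-child ξs blocks (C m) (C-bounded m (<-trans (n<1+n m) m+1<n)) only-m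
      where
      only-m : ∀ k l → k < n → l < n → childIdx ξs k ≡ C m → childIdx ξs l ≡ C m → k ≡ l
      only-m k l k<n l<n ck cl with read-at k k<n | read-at l l<n
      ... | t₁ , t₁<n , refl | t₂ , t₂<n , refl = cong X (trans (lone t₁ t₁<n ck) (sym (lone t₂ t₂<n cl)))

    -- C 0 together with the point m is read in one piece: entering it at suc i
    -- would be a return to C 0 (so i = m, which lies in the union) or a visit
    -- of point m (so i < m, which lies in C 0)
    union-one-piece : pieces (λ k → inChild ξs (C 0) k ∨ inChild ξs (C m) k) p ≡ 1
    union-one-piece = ≤-antisym at-most-one at-least-one
      where
      E : ℕ → Bool
      E k = inChild ξs (C 0) k ∨ inChild ξs (C m) k
      at-most-one : pieces E p ≤ 1
      at-most-one with 2 ≤? pieces E p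
      ... | no  ≱2 = ≤-pred (≰⇒> ≱2)
      ... | yes ≥2 with second-piece E false p ≥2
      ...   | i , _ , _ , _ , (si< , out , back) with ∨-false (C i ≡ᵇ C 0) (C i ≡ᵇ C m) out
      ...     | out₀ , outₘ with ∨-true (C (suc i) ≡ᵇ C 0) (C (suc i) ≡ᵇ C m) back
      ...       | inj₁ back₀ = ⊥-elim (≡ᵇ-false _ _ outₘ
                    (cong C (unique-return sc i (from-p si<) (≡ᵇ-true _ _ back₀) (≡ᵇ-false _ _ out₀))))
      ...       | inj₂ backₘ = ⊥-elim (≡ᵇ-false _ _ out₀
                    (before i (subst (i <_) (lone (suc i) (from-p si<) (≡ᵇ-true _ _ backₘ)) (n<1+n i))))
      at-least-one : 1 ≤ pieces E p
      at-least-one = first-piece E p (to-p (≤-<-trans z≤n m+1<n)) (cong (_∨ (C 0 ≡ᵇ C m)) (≡ᵇ-refl (C 0)))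

  first-child-reread : 2 ≤ pieces (inChild ξs (C 0)) p →
    pieces (inChild ξs (C 0)) p ≡ 2
    × ∃ λ m → m < length p
      × (∀ l → l < m → C l ≡ C 0)
      × C m ≢ C 0
      × (suc (C m) ≡ C 0 ⊎ C m ≡ suc (C 0))
      × childSize ξs (C m) ≡ 1
      × pieces (λ k → inChild ξs (C 0) k ∨ inChild ξs (C m) k) p ≡ 1
  first-child-reread ≥2 with second-piece (inChild ξs (C 0)) false p ≥2
  ... | i , _ , _ , _ , (si< , out , back) =
    ≤-antisym (first-child-two-pieces sc) ≥2 ,
    m , to-p (<-trans (n<1+n m) m+1<n) , before , leaves , adjacent ,
    second-child-singleton sc , union-one-piece sc
    where
    sc : SecondChild
    sc = second-child i (from-p si<) (≡ᵇ-true _ _ back) (≡ᵇ-false _ _ out)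
    open SecondChild sc

lemmaB9 : (ξs : List (List ℕ)) → 2 ≤ length ξs → All IsIncOsc ξs →
    (p : List ℕ) → IsPinRep (⊕ ξs) p →
    (∀ j → j < length ξs → j ≢ childIdx ξs (at p 0) → pieces (inChild ξs j) p ≤ 1)
    × (2 ≤ pieces (inChild ξs (childIdx ξs (at p 0))) p →
        pieces (inChild ξs (childIdx ξs (at p 0))) p ≡ 2
        × ∃ λ m → m < length p
          × (∀ l → l < m → childIdx ξs (at p l) ≡ childIdx ξs (at p 0))
          × childIdx ξs (at p m) ≢ childIdx ξs (at p 0)
          × (suc (childIdx ξs (at p m)) ≡ childIdx ξs (at p 0)
             ⊎ childIdx ξs (at p m) ≡ suc (childIdx ξs (at p 0)))
          × childSize ξs (childIdx ξs (at p m)) ≡ 1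
          × pieces (λ k → inChild ξs (childIdx ξs (at p 0)) k ∨ inChild ξs (childIdx ξs (at p m)) k) p ≡ 1)
lemmaB9 ξs _ incOsc p rep = (λ j _ → other-child-one-piece j) , first-child-reread
  where open PinRepresentation ξs incOsc p rep
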